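{- Let $G=(V,E)$ be a finite connected loopless graph with edge lengths $\ell:E\to\mathbb{Z}_{>0}$, let $H$ be its subdivision (notation in the context), and let $D$ be a divisor on $H$. For each $f\colon V(G)\to\mathbb{Z}$ there is a unique function $\widetilde f\colon V(H)\to\mathbb{Z}$ with $\widetilde f|_{V(G)}=f$ such that $D+\operatorname{div}(\widetilde f)$ is $G$-admissible. Moreover, this $\widetilde f$ is alternatively characterized by the following two properties: (1) for each oriented edge $e=uv$ of $G$ and each $j=1,\dots,\ell_e-1$, the divisor $D+\operatorname{div}(\widetilde f)$ takes value $0$ at $x^e_j$, unless $\ell_e-j$ is the remainder of the division of $f(v)-f(u)+t^D_e$ by $\ell_e$, in which case it takes value $1$; (2) $\widetilde f(x^e_1)=f(u)+\delta_e(f;t^D)$ for each oriented edge $e=uv$ of $G$.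
   Context: $G=(V,E)$ is a finite connected graph without loops (multiple edges allowed); $\mathbb{E}$ is its set of oriented edges ($e=uv$ has tail $u$, head $v$; $\bar e$ is the reverse), and $\ell$ is extended to $\mathbb{E}$ by $\ell_{\bar e}=\ell_e$. $H$ is obtained by replacing each oriented edge $e=uv$ by a path $u\,x^e_1\cdots x^e_{\ell_e-1}\,v$, with $x^e_0=u$, $x^e_{\ell_e}=v$ and $x^e_i=x^{\bar e}_{\ell_e-i}$. Divisors on $H$ are elements of the free abelian group on $V(H)$; for $F\colon V(H)\to\mathbb{Z}$, $\operatorname{div}(F)(w)=\sum(F(w')-F(w))$ summed over edges of $H$ at $w$ with other endpoint $w'$. A divisor $D$ on $H$ is $G$-admissible if for each oriented edge $e$ of $G$, the values $D(x^e_j)$, $1\le j\le\ell_e-1$, are $0$ except for at most one $j$ where the value is $1$. For a divisor $D$ on $H$, $t^D\colon\mathbb{E}\to\mathbb{Z}$ is $t^D_e=\sum_{j=1}^{\ell_e-1}(\ell_e-j)D(x^e_j)$, and for $t\colon\mathbb{E}\to\mathbb{Z}$, $f\colon V(G)\to\mathbb{Z}$, $e=uv$: $\delta_e(f;t)=\lfloor (f(v)-f(u)+t_e)/\ell_e\rfloor$. -}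

module Defs where

open import Data.Nat as ℕ using (ℕ; zero; suc; _∸_; _<_; _≤_; _<?_; NonZero; s≤s; z≤n)
open import Data.Integer as ℤ using (ℤ; +_; _/ℕ_; _%ℕ_)
open import Data.Fin using (Fin; _≟_)
open import Data.List using (List; []; _∷_; _++_; map; foldr; concatMap)
open import Data.List.Base using ()
open import Data.Bool using (Bool; if_then_else_)
open import Data.Product using (_×_)
open import Data.Sum using (_⊎_)
open import Relation.Nullary using (¬_; yes; no; does)
open import Relation.Binary.PropositionalEquality using (_≡_; _≢_)

record Graph : Set where
  field
    n m      : ℕ
    src tgt  : Fin m → Fin n
    loopless : ∀ e → src e ≢ tgt e
    len      : Fin m → ℕ
    len-nz   : ∀ e → NonZero (len e)

module _ (G : Graph) where
  open Graph G

  data Reach : Fin n → Fin n → Set where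
    here  : ∀ {u} → Reach u u
    fwd   : ∀ e {w} → Reach (tgt e) w → Reach (src e) w
    bwd   : ∀ e {w} → Reach (src e) w → Reach (tgt e) w

  Connected : Set
  Connected = ∀ u v → Reach u v

  -- vertices of the subdivision H: original vertices, and interior
  -- vertices  inner e i  (0 < i < len e) of the path replacing e,
  -- numbered from src e.
  data VH : Set where
    vert  : Fin n → VH
    inner : (e : Fin m) (i : ℕ) → 0 < i → i < len e → VH

  pos : Fin m → ℕ → VH
  pos e zero = vert (src e)
  pos e (suc k) with suc k <? len e
  ... | yes p = inner e (suc k) (s≤s z≤n) p
  ... | no _  = vert (tgt e)

  -- oriented edges: (e , true) = src e → tgt e ; (e , false) = reverse
  record OEdge : Set where
    constructor oe
    field
      edge : Fin m
      dir  : Bool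
  open OEdge public

  ℓ : OEdge → ℕ
  ℓ o = len (edge o)

  tail head : OEdge → Fin n
  tail (oe e Bool.true)  = src e
  tail (oe e Bool.false) = tgt e
  head (oe e Bool.true)  = tgt e
  head (oe e Bool.false) = src e

  -- x^o_j,  0 ≤ j ≤ ℓ o ; x^o_0 = tail o, x^o_{ℓ} = head o,
  -- and x^{ō}_j = x^o_{ℓ - j}
  x : OEdge → ℕ → VH
  x (oe e Bool.true)  j = pos e j
  x (oe e Bool.false) j = pos e (len e ∸ j)

  nbrs : VH → List VH
  nbrs (vert v) = concatMap
    (λ e → (if does (src e ≟ v) then pos e 1 ∷ [] else [])
        ++ (if does (tgt e ≟ v) then pos e (len e ∸ 1) ∷ [] else []))
    (Data.List.allFin m)
  nbrs (inner e i _ _) = pos e (i ∸ 1) ∷ pos e (suc i) ∷ []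

  -- divisors on H (V(H) is finite, so these are the elements of ℤ^{V(H)})
  Divisor : Set
  Divisor = VH → ℤ

  _⊕_ : Divisor → Divisor → Divisor
  (D ⊕ D') w = D w ℤ.+ D' w

  div : (VH → ℤ) → Divisor
  div F w = foldr ℤ._+_ (+ 0) (map (λ w' → F w' ℤ.- F w) (nbrs w))

  Interior : OEdge → ℕ → Set
  Interior o j = (1 ≤ j) × (j < ℓ o)

  Admissible : Divisor → Set
  Admissible D = ∀ o →
      (∀ j → Interior o j → D (x o j) ≡ + 0 ⊎ D (x o j) ≡ + 1)
    × (∀ j k → Interior o j → Interior o k →
         D (x o j) ≡ + 1 → D (x o k) ≡ + 1 → j ≡ k)

  sumTo : ℕ → (ℕ → ℤ) → ℤ
  sumTo zero    g = + 0
  sumTo (suc k) g = sumTo k g ℤ.+ g (suc k)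

  tD : Divisor → OEdge → ℤ
  tD D o = sumTo (ℓ o ∸ 1) (λ j → + (ℓ o ∸ j) ℤ.* D (x o j))

  slope : (Fin n → ℤ) → (OEdge → ℤ) → OEdge → ℤ
  slope f t o = f (head o) ℤ.- f (tail o) ℤ.+ t o

  -- δ_e(f;t) = ⌊(f(v) - f(u) + t_e) / ℓ_e⌋  (floor division by ℓ_e > 0)
  δ : (Fin n → ℤ) → (OEdge → ℤ) → OEdge → ℤ
  δ f t o = _/ℕ_ (slope f t o) (ℓ o) {{len-nz (edge o)}}

  rem : (Fin n → ℤ) → (OEdge → ℤ) → OEdge → ℕ
  rem f t o = _%ℕ_ (slope f t o) (ℓ o) {{len-nz (edge o)}}

  Extends : (VH → ℤ) → (Fin n → ℤ) → Set
  Extends F f = ∀ v → F (vert v) ≡ f v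

  Prop1 : Divisor → (Fin n → ℤ) → (VH → ℤ) → Set
  Prop1 D f F = ∀ o j → Interior o j →
      (ℓ o ∸ j ≡ rem f (tD D) o → (D ⊕ div F) (x o j) ≡ + 1)
    × (¬ (ℓ o ∸ j ≡ rem f (tD D) o) → (D ⊕ div F) (x o j) ≡ + 0)

  Prop2 : Divisor → (Fin n → ℤ) → (VH → ℤ) → Set
  Prop2 D f F = ∀ o → F (x o 1) ≡ f (tail o) ℤ.+ δ f (tD D) o

-- Along an edge of length L, read the divisor D + div F as c j = d j + Δ h j, where d is D along
-- the edge, h is F along the edge and Δ the discrete Laplacian. Summation by parts gives
--   Σ_{j=1}^{L-1} (L - j) c j = h L - h 0 + t - L (h 1 - h 0),   t = Σ_{j=1}^{L-1} (L - j) d j.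
-- If c is admissible, the left side is L - j₀ for the unique j₀ with c j₀ = 1, or 0; either way it
-- lies in [0, L). So h 1 - h 0 and that value are the quotient and the remainder of
-- h L - h 0 + t by L, which gives properties (1) and (2). Conversely, h 0, h 1 and Δ h determine h,
-- and integrating the Laplacian prescribed by (1) from the slope prescribed by (2) produces an
-- admissible extension, whose endpoint value is correct by the same identity.
module Submission where

open import Defs
open import Data.Fin using (Fin)
open import Data.Integer using (ℤ)
open import Data.Product using (Σ-syntax; _×_)
open import Relation.Binary.PropositionalEquality using (_≡_)

open import Data.Bool using (true; false)
open import Data.Integer as ℤ using (+_; -[1+_]; _+_; _-_; _*_; -_; _/ℕ_; _%ℕ_)
import Data.Integer.Properties as ℤₚ
open import Data.Integer.DivMod using (a≡a%ℕn+[a/ℕn]*n; n%ℕd<d)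
open import Data.Integer.Tactic.RingSolver using (solve-∀)
open import Algebra.Properties.AbelianGroup ℤₚ.+-0-abelianGroup using (∙-cancelˡ)
open import Algebra.Properties.CommutativeSemigroup ℤₚ.+-commutativeSemigroup using (interchange)
open import Data.Nat as ℕ using (ℕ; zero; suc; _∸_; _≤_; _<_; NonZero; s≤s; z≤n)
import Data.Nat.Properties as ℕₚ
open import Data.Product using (_,_; proj₁; proj₂)
open import Data.Sum using (_⊎_; inj₁; inj₂)
open import Relation.Nullary using (¬_; yes; no; contradiction)
open import Relation.Nullary.Decidable using (_×-dec_)
open import Function using (_∘_)
open import Relation.Binary.PropositionalEquality
  using (_≢_; refl; sym; trans; cong; cong₂; subst; module ≡-Reasoning)

open ≡-Reasoning

multiple-≤ : ∀ a m L b → + a + + suc m * + L ≡ + b → L ≤ b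
multiple-≤ a m L b eq = subst (L ≤_) a+[1+m]L≡b
  (ℕₚ.≤-trans (ℕₚ.m≤m+n L (m ℕ.* L)) (ℕₚ.m≤n+m (suc m ℕ.* L) a))
  where
  a+[1+m]L≡b : a ℕ.+ suc m ℕ.* L ≡ b
  a+[1+m]L≡b = ℤₚ.+-injective
    (trans (ℤₚ.pos-+ a (suc m ℕ.* L)) (trans (cong (_+_ (+ a)) (ℤₚ.pos-* (suc m) L)) eq))

bounded-multiple≡0 : ∀ {L r r′} k → r < L → r′ < L → + r + k * + L ≡ + r′ → k ≡ + 0
bounded-multiple≡0 (+ zero)  _   _    _  = refl
bounded-multiple≡0 (+ suc m) _   r′<L eq = contradiction (multiple-≤ _ m _ _ eq) (ℕₚ.<⇒≱ r′<L)
bounded-multiple≡0 {L} {r} {r′} -[1+ m ] r<L _ eq =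
  contradiction (multiple-≤ r′ m L r (sym (trans (add-back (+ r) (+ suc m) (+ L))
                                                 (cong (_+ + suc m * + L) eq))))
                (ℕₚ.<⇒≱ r<L)
  where
  add-back : ∀ a k l → a ≡ (a + (- k) * l) + k * l
  add-back = solve-∀

/ℕ-%ℕ-unique : ∀ s L .{{_ : NonZero L}} q r → r < L → s ≡ + r + q * + L →
               s /ℕ L ≡ q × s %ℕ L ≡ r
/ℕ-%ℕ-unique s L q r r<L s≡ = ℤₚ.i-j≡0⇒i≡j _ q k≡0 , ℤₚ.+-injective r₀≡r
  where
  k = s /ℕ L - q
  shift : ∀ a b c l → a + (b - c) * l ≡ (a + b * l) - c * l
  shift = solve-∀
  unshift : ∀ a c l → (a + c * l) - c * l ≡ a
  unshift = solve-∀
  r₀+kL≡r : + (s %ℕ L) + k * + L ≡ + r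
  r₀+kL≡r = begin
    + (s %ℕ L) + k * + L                    ≡⟨ shift (+ (s %ℕ L)) (s /ℕ L) q (+ L) ⟩
    (+ (s %ℕ L) + s /ℕ L * + L) - q * + L   ≡⟨ cong (_- q * + L) (trans (sym (a≡a%ℕn+[a/ℕn]*n s L)) s≡) ⟩
    (+ r + q * + L) - q * + L               ≡⟨ unshift (+ r) q (+ L) ⟩
    + r                                     ∎
  k≡0 : k ≡ + 0
  k≡0 = bounded-multiple≡0 k (n%ℕd<d s L) r<L r₀+kL≡r
  r₀≡r : + (s %ℕ L) ≡ + r
  r₀≡r = trans (sym (ℤₚ.+-identityʳ _)) (trans (cong (λ k → + (s %ℕ L) + k * + L) (sym k≡0)) r₀+kL≡r)

∑ : ℕ → (ℕ → ℤ) → ℤ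
∑ zero    a = + 0
∑ (suc n) a = ∑ n a + a (suc n)

∑-cong : ∀ n {a b : ℕ → ℤ} → (∀ j → 1 ≤ j → j ≤ n → a j ≡ b j) → ∑ n a ≡ ∑ n b
∑-cong zero    eq = refl
∑-cong (suc n) eq =
  cong₂ _+_ (∑-cong n λ j 1≤j j≤n → eq j 1≤j (ℕₚ.m≤n⇒m≤1+n j≤n)) (eq (suc n) (s≤s z≤n) ℕₚ.≤-refl)

∑-distrib-+ : ∀ n (a b : ℕ → ℤ) → ∑ n (λ j → a j + b j) ≡ ∑ n a + ∑ n b
∑-distrib-+ zero    a b = refl
∑-distrib-+ (suc n) a b =
  trans (cong (_+ (a (suc n) + b (suc n))) (∑-distrib-+ n a b))
        (interchange (∑ n a) (∑ n b) (a (suc n)) (b (suc n)))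

∑-zero : ∀ n {a : ℕ → ℤ} → (∀ j → 1 ≤ j → j ≤ n → a j ≡ + 0) → ∑ n a ≡ + 0
∑-zero zero    _    = refl
∑-zero (suc n) vanish = cong₂ _+_ (∑-zero n λ j 1≤j j≤n → vanish j 1≤j (ℕₚ.m≤n⇒m≤1+n j≤n))
                                  (vanish (suc n) (s≤s z≤n) ℕₚ.≤-refl)

∑-single : ∀ n {k} {a : ℕ → ℤ} → 1 ≤ k → k ≤ n →
           (∀ j → 1 ≤ j → j ≤ n → j ≢ k → a j ≡ + 0) → ∑ n a ≡ a k
∑-single zero    1≤k k≤0 _ = contradiction (ℕₚ.≤-trans 1≤k k≤0) λ ()
∑-single (suc n) {k} {a} 1≤k k≤1+n off with k ℕ.≟ suc n
... | yes refl = trans (cong (_+ a k) (∑-zero n λ j 1≤j j≤n → off j 1≤j (ℕₚ.m≤n⇒m≤1+n j≤n)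
                                                               (ℕₚ.<⇒≢ (s≤s j≤n))))
                       (ℤₚ.+-identityˡ (a k))
... | no k≢1+n = trans (cong₂ _+_ (∑-single n 1≤k (ℕₚ.≤-pred (ℕₚ.≤∧≢⇒< k≤1+n k≢1+n))
                                            λ j 1≤j j≤n → off j 1≤j (ℕₚ.m≤n⇒m≤1+n j≤n))
                                  (off (suc n) (s≤s z≤n) ℕₚ.≤-refl (k≢1+n ∘ sym)))
                       (ℤₚ.+-identityʳ (a k))

-- Written in the shape that div takes at an inner vertex of H (a foldr over its two neighbours),
-- so that the two agree definitionally once that vertex is named by pos.
Δ : (ℕ → ℤ) → ℕ → ℤ
Δ h j = (h (j ∸ 1) - h j) + ((h (suc j) - h j) + + 0)

∑-Δ : ∀ n h → ∑ n (Δ h) ≡ (h (suc n) - h n) - (h 1 - h 0)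
∑-Δ zero    h = empty (h 1) (h 0)
  where
  empty : ∀ a b → + 0 ≡ (a - b) - (a - b)
  empty = solve-∀
∑-Δ (suc n) h =
  trans (cong (_+ Δ h (suc n)) (∑-Δ n h)) (step (h 0) (h 1) (h n) (h (suc n)) (h (suc (suc n))))
  where
  step : ∀ a b c d e → ((d - c) - (b - a)) + ((c - d) + ((e - d) + + 0)) ≡ (e - d) - (b - a)
  step = solve-∀

∑-weighted-Δ : ∀ n h → ∑ n (λ j → + (suc n ∸ j) * Δ h j) ≡ h (suc n) - h 0 - + suc n * (h 1 - h 0)
∑-weighted-Δ zero    h = base (h 0) (h 1)
  where
  base : ∀ a b → + 0 ≡ b - a - + 1 * (b - a)
  base = solve-∀
∑-weighted-Δ (suc n) h = begin
  ∑ n (λ j → + (2+n ∸ j) * Δ h j) + + (2+n ∸ suc n) * Δ h (suc n)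
    ≡⟨ cong₂ _+_ (∑-cong n weight-split) (cong (λ k → + k * Δ h (suc n)) (ℕₚ.m+n∸n≡m 1 (suc n))) ⟩
  ∑ n (λ j → + (suc n ∸ j) * Δ h j + Δ h j) + + 1 * Δ h (suc n)
    ≡⟨ cong (_+ + 1 * Δ h (suc n))
            (trans (∑-distrib-+ n _ (Δ h)) (cong₂ _+_ (∑-weighted-Δ n h) (∑-Δ n h))) ⟩
  ((h (suc n) - h 0 - + suc n * (h 1 - h 0)) + ((h (suc n) - h n) - (h 1 - h 0))) + + 1 * Δ h (suc n)
    ≡⟨ step (h 0) (h 1) (h n) (h (suc n)) (h (suc (suc n))) (+ suc n) ⟩
  h (suc (suc n)) - h 0 - + suc (suc n) * (h 1 - h 0)
    ∎
  where
  2+n = suc (suc n)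
  one-more : ∀ k d → (+ 1 + k) * d ≡ k * d + d
  one-more = solve-∀
  weight-split : ∀ j → 1 ≤ j → j ≤ n → + (2+n ∸ j) * Δ h j ≡ + (suc n ∸ j) * Δ h j + Δ h j
  weight-split j _ j≤n = trans (cong (λ k → + k * Δ h j) (ℕₚ.+-∸-assoc 1 (ℕₚ.m≤n⇒m≤1+n j≤n)))
                               (one-more (+ (suc n ∸ j)) (Δ h j))
  step : ∀ a b c d e k →
         ((d - a - k * (b - a)) + ((d - c) - (b - a))) + + 1 * ((c - d) + ((e - d) + + 0))
         ≡ e - a - (+ 1 + k) * (b - a)
  step = solve-∀

Inner : ℕ → ℕ → Set
Inner L j = 1 ≤ j × j < L

Inner-reverse : ∀ {L j} → Inner L j → Inner L (L ∸ j)
Inner-reverse (1≤j , j<L) = ℕₚ.m<n⇒0<n∸m j<L , ℕₚ.∸-monoʳ-< 1≤j (ℕₚ.<⇒≤ j<L)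

-- For an oriented edge o, Admissible and Prop1 at o are definitionally PathAdmissible and
-- ConcentratedAt of the divisor read along o.
PathAdmissible : ℕ → (ℕ → ℤ) → Set
PathAdmissible L c = (∀ j → Inner L j → c j ≡ + 0 ⊎ c j ≡ + 1)
                   × (∀ j k → Inner L j → Inner L k → c j ≡ + 1 → c k ≡ + 1 → j ≡ k)

ConcentratedAt : ℕ → ℕ → (ℕ → ℤ) → Set
ConcentratedAt L r c = ∀ j → Inner L j → (L ∸ j ≡ r → c j ≡ + 1) × (¬ (L ∸ j ≡ r) → c j ≡ + 0)

weightedSum : ℕ → (ℕ → ℤ) → ℤ
weightedSum L c = ∑ (L ∸ 1) (λ j → + (L ∸ j) * c j)

PathAdmissible-resp : ∀ {L c c′} → (∀ j → Inner L j → c j ≡ c′ j) →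
                      PathAdmissible L c → PathAdmissible L c′
PathAdmissible-resp c≡c′ (zero-or-one , unique) =
  (λ j ij → subst (λ v → v ≡ + 0 ⊎ v ≡ + 1) (c≡c′ j ij) (zero-or-one j ij)) ,
  (λ j k ij ik c′j≡1 c′k≡1 → unique j k ij ik (trans (c≡c′ j ij) c′j≡1) (trans (c≡c′ k ik) c′k≡1))

PathAdmissible-reverse : ∀ {L c} → PathAdmissible L c → PathAdmissible L (λ j → c (L ∸ j))
PathAdmissible-reverse (zero-or-one , unique) =
  (λ j ij → zero-or-one _ (Inner-reverse ij)) ,
  (λ j k ij ik cj≡1 ck≡1 → ℕₚ.∸-cancelˡ-≡ (ℕₚ.<⇒≤ (proj₂ ij)) (ℕₚ.<⇒≤ (proj₂ ik))
                             (unique _ _ (Inner-reverse ij) (Inner-reverse ik) cj≡1 ck≡1))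

PathAdmissible-≢1⇒≡0 : ∀ {L c j} → PathAdmissible L c → Inner L j → ¬ c j ≡ + 1 → c j ≡ + 0
PathAdmissible-≢1⇒≡0 {j = j} (zero-or-one , _) ij cj≢1 with zero-or-one j ij
... | inj₁ cj≡0 = cj≡0
... | inj₂ cj≡1 = contradiction cj≡1 cj≢1

concentrated⇒admissible : ∀ {L r c} → ConcentratedAt L r c → PathAdmissible L c
concentrated⇒admissible {L} {r} {c} conc = zero-or-one , unique
  where
  zero-or-one : ∀ j → Inner L j → c j ≡ + 0 ⊎ c j ≡ + 1
  zero-or-one j ij with L ∸ j ℕ.≟ r
  ... | yes at-r = inj₂ (proj₁ (conc j ij) at-r)
  ... | no ¬at-r = inj₁ (proj₂ (conc j ij) ¬at-r)
  one⇒at-r : ∀ j → Inner L j → c j ≡ + 1 → L ∸ j ≡ r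
  one⇒at-r j ij cj≡1 with L ∸ j ℕ.≟ r
  ... | yes at-r = at-r
  ... | no ¬at-r = contradiction (trans (sym (proj₂ (conc j ij) ¬at-r)) cj≡1) λ ()
  unique : ∀ j k → Inner L j → Inner L k → c j ≡ + 1 → c k ≡ + 1 → j ≡ k
  unique j k ij ik cj≡1 ck≡1 = ℕₚ.∸-cancelˡ-≡ (ℕₚ.<⇒≤ (proj₂ ij)) (ℕₚ.<⇒≤ (proj₂ ik))
                                  (trans (one⇒at-r j ij cj≡1) (sym (one⇒at-r k ik ck≡1)))

admissible⇒concentrated : ∀ L .{{_ : NonZero L}} {c} → PathAdmissible L c →
                          Σ[ r ∈ ℕ ] r < L × ConcentratedAt L r c
admissible⇒concentrated L {c} adm
  with ℕₚ.anyUpTo? (λ k → 1 ℕ.≤? k ×-dec c k ℤ.≟ + 1) L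
... | yes (k , k<L , 1≤k , ck≡1) = L ∸ k , proj₂ (Inner-reverse (1≤k , k<L)) , at-k
  where
  at-k : ConcentratedAt L (L ∸ k) c
  at-k j ij =
    (λ L∸j≡L∸k → subst (λ i → c i ≡ + 1)
                       (sym (ℕₚ.∸-cancelˡ-≡ (ℕₚ.<⇒≤ (proj₂ ij)) (ℕₚ.<⇒≤ k<L) L∸j≡L∸k)) ck≡1) ,
    (λ L∸j≢L∸k → PathAdmissible-≢1⇒≡0 adm ij λ cj≡1 →
                   L∸j≢L∸k (cong (L ∸_) (proj₂ adm j k ij (1≤k , k<L) cj≡1 ck≡1)))
... | no no-one = 0 , ℕ.>-nonZero⁻¹ L , nowhere
  where
  nowhere : ConcentratedAt L 0 c
  nowhere j ij =
    (λ L∸j≡0 → contradiction (ℕₚ.m<n⇒0<n∸m (proj₂ ij)) (ℕₚ.<-irrefl (sym L∸j≡0))) ,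
    (λ _ → PathAdmissible-≢1⇒≡0 adm ij λ cj≡1 → no-one (j , proj₂ ij , proj₁ ij , cj≡1))

concentrated-unique : ∀ {L r c c′} → ConcentratedAt L r c → ConcentratedAt L r c′ →
                      ∀ j → Inner L j → c j ≡ c′ j
concentrated-unique {L} {r} conc conc′ j ij with L ∸ j ℕ.≟ r
... | yes at-r = trans (proj₁ (conc j ij) at-r) (sym (proj₁ (conc′ j ij) at-r))
... | no ¬at-r = trans (proj₂ (conc j ij) ¬at-r) (sym (proj₂ (conc′ j ij) ¬at-r))

weightedSum-cong : ∀ L {c c′} → (∀ j → Inner L j → c j ≡ c′ j) → weightedSum L c ≡ weightedSum L c′
weightedSum-cong zero    _    = refl
weightedSum-cong (suc n) c≡c′ = ∑-cong n λ j 1≤j j≤n → cong (+ (suc n ∸ j) *_) (c≡c′ j (1≤j , s≤s j≤n))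

weightedSum-concentrated : ∀ L {r c} → r < L → ConcentratedAt L r c → weightedSum L c ≡ + r
weightedSum-concentrated (suc n) {zero} _ conc = ∑-zero n λ j 1≤j j≤n →
  trans (cong (+ (suc n ∸ j) *_) (proj₂ (conc j (1≤j , s≤s j≤n))
                                        λ L∸j≡0 → ℕₚ.<-irrefl (sym L∸j≡0) (ℕₚ.m<n⇒0<n∸m (s≤s j≤n))))
        (ℤₚ.*-zeroʳ (+ (suc n ∸ j)))
weightedSum-concentrated (suc n) {suc r′} {c} r<L conc = begin
  ∑ n (λ j → + (L ∸ j) * c j)  ≡⟨ ∑-single n (proj₁ ik) (ℕₚ.≤-pred (proj₂ ik)) elsewhere ⟩
  + (L ∸ k) * c k              ≡⟨ cong₂ _*_ (cong +_ L∸k≡r) (proj₁ (conc k ik) L∸k≡r) ⟩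
  + suc r′ * + 1               ≡⟨ ℤₚ.*-identityʳ (+ suc r′) ⟩
  + suc r′                     ∎
  where
  L = suc n
  k = L ∸ suc r′
  ik : Inner L k
  ik = ℕₚ.m<n⇒0<n∸m r<L , ℕₚ.∸-monoʳ-< (s≤s z≤n) (ℕₚ.<⇒≤ r<L)
  L∸k≡r : L ∸ k ≡ suc r′
  L∸k≡r = ℕₚ.m∸[m∸n]≡n (ℕₚ.<⇒≤ r<L)
  elsewhere : ∀ j → 1 ≤ j → j ≤ n → j ≢ k → + (L ∸ j) * c j ≡ + 0
  elsewhere j 1≤j j≤n j≢k = trans
    (cong (+ (L ∸ j) *_) (proj₂ (conc j (1≤j , s≤s j≤n)) λ L∸j≡r →
       j≢k (ℕₚ.∸-cancelˡ-≡ (ℕₚ.m≤n⇒m≤1+n j≤n) (ℕₚ.<⇒≤ (proj₂ ik)) (trans L∸j≡r (sym L∸k≡r)))))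
    (ℤₚ.*-zeroʳ (+ (L ∸ j)))

weightedSum-+Δ : ∀ n (d h : ℕ → ℤ) →
  weightedSum (suc n) (λ j → d j + Δ h j)
  ≡ weightedSum (suc n) d + (h (suc n) - h 0 - + suc n * (h 1 - h 0))
weightedSum-+Δ n d h = begin
  ∑ n (λ j → + (suc n ∸ j) * (d j + Δ h j))
    ≡⟨ ∑-cong n (λ j _ _ → ℤₚ.*-distribˡ-+ (+ (suc n ∸ j)) (d j) (Δ h j)) ⟩
  ∑ n (λ j → + (suc n ∸ j) * d j + + (suc n ∸ j) * Δ h j)
    ≡⟨ ∑-distrib-+ n _ _ ⟩
  weightedSum (suc n) d + ∑ n (λ j → + (suc n ∸ j) * Δ h j)
    ≡⟨ cong (_+_ (weightedSum (suc n) d)) (∑-weighted-Δ n h) ⟩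
  weightedSum (suc n) d + (h (suc n) - h 0 - + suc n * (h 1 - h 0))
    ∎

Δ-cong-≤ : ∀ {L j} {g h : ℕ → ℤ} → (∀ i → i ≤ L → g i ≡ h i) → Inner L j → Δ g j ≡ Δ h j
Δ-cong-≤ {L} {j} g≡h (_ , j<L) =
  cong₂ _+_ (cong₂ _-_ (g≡h (j ∸ 1) (ℕₚ.≤-trans (ℕₚ.m∸n≤m j 1) j≤L)) (g≡h j j≤L))
            (cong (_+ + 0) (cong₂ _-_ (g≡h (suc j) j<L) (g≡h j j≤L)))
  where
  j≤L = ℕₚ.<⇒≤ j<L

m∸n≡1+[m∸1+n] : ∀ {m n} → n < m → m ∸ n ≡ suc (m ∸ suc n)
m∸n≡1+[m∸1+n] {suc m} (s≤s n≤m) = ℕₚ.+-∸-assoc 1 n≤m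

Δ-reverse : ∀ {L j} h → Inner L j → Δ (λ i → h (L ∸ i)) j ≡ Δ h (L ∸ j)
Δ-reverse {L} {suc j} h (_ , j<L) = begin
  (h (L ∸ j) - h i) + ((h (L ∸ suc (suc j)) - h i) + + 0)
    ≡⟨ swap (h (L ∸ j)) (h (L ∸ suc (suc j))) (h i) ⟩
  (h (L ∸ suc (suc j)) - h i) + ((h (L ∸ j) - h i) + + 0)
    ≡⟨ cong₂ (λ a b → (h a - h i) + ((h b - h i) + + 0))
             (sym i∸1≡L∸2+j) (m∸n≡1+[m∸1+n] (ℕₚ.<⇒≤ j<L)) ⟩
  (h (i ∸ 1) - h i) + ((h (suc i) - h i) + + 0)
    ∎
  where
  i = L ∸ suc j
  i∸1≡L∸2+j : i ∸ 1 ≡ L ∸ suc (suc j)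
  i∸1≡L∸2+j = trans (ℕₚ.∸-+-assoc L (suc j) 1) (cong (L ∸_) (ℕₚ.+-comm (suc j) 1))
  swap : ∀ a b c → (a - c) + ((b - c) + + 0) ≡ (b - c) + ((a - c) + + 0)
  swap = solve-∀

Δ-step : ∀ h i → h (suc (suc i)) ≡ Δ h (suc i) - (h i - h (suc i)) + h (suc i)
Δ-step h i = solve-step (h i) (h (suc i)) (h (suc (suc i)))
  where
  solve-step : ∀ a b c → c ≡ ((a - b) + ((c - b) + + 0)) - (a - b) + b
  solve-step = solve-∀

Δ-determines : ∀ {L} {g h : ℕ → ℤ} → g 0 ≡ h 0 → g 1 ≡ h 1 → (∀ j → Inner L j → Δ g j ≡ Δ h j) →
               ∀ i → i ≤ L → g i ≡ h i
Δ-determines {L} {g} {h} g₀≡h₀ g₁≡h₁ sameΔ = agree-≤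
  where
  agree-pair : ∀ i → suc i ≤ L → g i ≡ h i × g (suc i) ≡ h (suc i)
  agree-pair zero    _      = g₀≡h₀ , g₁≡h₁
  agree-pair (suc i) 2+i≤L with agree-pair i (ℕₚ.≤-trans (ℕₚ.n≤1+n (suc i)) 2+i≤L)
  ... | gi≡hi , g1+i≡h1+i = g1+i≡h1+i , (begin
    g (suc (suc i))
      ≡⟨ Δ-step g i ⟩
    Δ g (suc i) - (g i - g (suc i)) + g (suc i)
      ≡⟨ cong₂ _+_ (cong₂ _-_ (sameΔ (suc i) (s≤s z≤n , 2+i≤L)) (cong₂ _-_ gi≡hi g1+i≡h1+i))
                   g1+i≡h1+i ⟩
    Δ h (suc i) - (h i - h (suc i)) + h (suc i)
      ≡⟨ Δ-step h i ⟨
    h (suc (suc i))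
      ∎)
  agree-≤ : ∀ i → i ≤ L → g i ≡ h i
  agree-≤ zero    _      = g₀≡h₀
  agree-≤ (suc i) 1+i≤L = proj₂ (agree-pair i 1+i≤L)

integrate : ℤ → ℤ → (ℕ → ℤ) → ℕ → ℤ
integrate a₀ a₁ u zero          = a₀
integrate a₀ a₁ u (suc zero)    = a₁
integrate a₀ a₁ u (suc (suc i)) = u (suc i) - (h i - h (suc i)) + h (suc i)
  where h = integrate a₀ a₁ u

Δ-integrate : ∀ a₀ a₁ u j → 1 ≤ j → Δ (integrate a₀ a₁ u) j ≡ u j
Δ-integrate a₀ a₁ u (suc i) _ = cancel (h i) (h (suc i)) (u (suc i))
  where
  h = integrate a₀ a₁ u
  cancel : ∀ a b v → (a - b) + ((v - (a - b) + b - b) + + 0) ≡ v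
  cancel = solve-∀

path-characterisation :
  ∀ L .{{_ : NonZero L}} (d h c : ℕ → ℤ) s →
  (∀ j → Inner L j → c j ≡ d j + Δ h j) → s ≡ h L - h 0 + weightedSum L d → PathAdmissible L c →
  h 1 ≡ h 0 + s /ℕ L × ConcentratedAt L (s %ℕ L) c
path-characterisation (suc n) d h c s c≡d+Δh s≡ adm
  with r , r<L , conc ← admissible⇒concentrated (suc n) adm =
  let q≡ , r≡ = /ℕ-%ℕ-unique s L (h 1 - h 0) r r<L s≡r+qL
  in trans (add-diff (h 0) (h 1)) (cong (_+_ (h 0)) (sym q≡)) ,
     subst (λ r → ConcentratedAt L r c) (sym r≡) conc
  where
  L = suc n
  add-diff : ∀ a b → b ≡ a + (b - a)
  add-diff = solve-∀
  regroup : ∀ a b c w l → a - b + w ≡ (w + (a - b - l * (c - b))) + (c - b) * l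
  regroup = solve-∀
  t = weightedSum L d
  r-by-parts : + r ≡ t + (h L - h 0 - + L * (h 1 - h 0))
  r-by-parts = begin
    + r                                ≡⟨ weightedSum-concentrated L r<L conc ⟨
    weightedSum L c                    ≡⟨ weightedSum-cong L c≡d+Δh ⟩
    weightedSum L (λ j → d j + Δ h j)  ≡⟨ weightedSum-+Δ n d h ⟩
    t + (h L - h 0 - + L * (h 1 - h 0)) ∎
  s≡r+qL : s ≡ + r + (h 1 - h 0) * + L
  s≡r+qL = begin
    s                                                         ≡⟨ s≡ ⟩
    h L - h 0 + t                                             ≡⟨ regroup (h L) (h 0) (h 1) t (+ L) ⟩
    (t + (h L - h 0 - + L * (h 1 - h 0))) + (h 1 - h 0) * + L ≡⟨ cong (_+ (h 1 - h 0) * + L) r-by-parts ⟨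
    + r + (h 1 - h 0) * + L                                   ∎

spike : ℕ → ℕ → ℕ → ℤ
spike L r j with L ∸ j ℕ.≟ r
... | yes _ = + 1
... | no  _ = + 0

spike-concentrated : ∀ L r → ConcentratedAt L r (spike L r)
spike-concentrated L r j _ with L ∸ j ℕ.≟ r
... | yes at-r = (λ _ → refl) , (λ ¬at-r → contradiction at-r ¬at-r)
... | no ¬at-r = (λ at-r → contradiction at-r ¬at-r) , (λ _ → refl)

path-existence : ∀ L .{{_ : NonZero L}} (d : ℕ → ℤ) A B →
                 Σ[ h ∈ (ℕ → ℤ) ] h 0 ≡ A × h L ≡ B × PathAdmissible L (λ j → d j + Δ h j)
path-existence (suc n) d A B =
  h , refl , h[L]≡B , PathAdmissible-resp (λ j ij → sym (d+Δh≡spike j ij)) (concentrated⇒admissible spikeᶜ)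
  where
  L = suc n
  s = B - A + weightedSum L d
  q = s /ℕ L
  r = s %ℕ L
  spikeᶜ = spike-concentrated L r
  h = integrate A (A + q) (λ j → spike L r j - d j)
  d+Δh≡spike : ∀ j → Inner L j → d j + Δ h j ≡ spike L r j
  d+Δh≡spike j (1≤j , _) =
    trans (cong (_+_ (d j)) (Δ-integrate A (A + q) _ j 1≤j)) (add-sub (d j) (spike L r j))
    where
    add-sub : ∀ a b → a + (b - a) ≡ b
    add-sub = solve-∀
  r-by-parts : + r ≡ weightedSum L d + (h L - A - + L * ((A + q) - A))
  r-by-parts = begin
    + r                                ≡⟨ weightedSum-concentrated L (n%ℕd<d s L) spikeᶜ ⟨
    weightedSum L (spike L r)          ≡⟨ weightedSum-cong L d+Δh≡spike ⟨
    weightedSum L (λ j → d j + Δ h j)  ≡⟨ weightedSum-+Δ n d h ⟩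
    weightedSum L d + (h L - A - + L * ((A + q) - A)) ∎
  isolate-end : ∀ e a w l q → e ≡ (w + (e - a - l * ((a + q) - a))) + q * l + a - w
  isolate-end = solve-∀
  cancel-end : ∀ b a w → (b - a + w) + a - w ≡ b
  cancel-end = solve-∀
  h[L]≡B : h L ≡ B
  h[L]≡B = begin
    h L
      ≡⟨ isolate-end (h L) A (weightedSum L d) (+ L) q ⟩
    (weightedSum L d + (h L - A - + L * ((A + q) - A))) + q * + L + A - weightedSum L d
      ≡⟨ cong (λ v → v + q * + L + A - weightedSum L d) r-by-parts ⟨
    + r + q * + L + A - weightedSum L d
      ≡⟨ cong (λ v → v + A - weightedSum L d) (a≡a%ℕn+[a/ℕn]*n s L) ⟨
    s + A - weightedSum L d
      ≡⟨ cancel-end B A (weightedSum L d) ⟩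
    B ∎

sumTo≡∑ : ∀ G k a → sumTo G k a ≡ ∑ k a
sumTo≡∑ G zero    a = refl
sumTo≡∑ G (suc k) a = cong (_+ a (suc k)) (sumTo≡∑ G k a)

module _ (G : Graph) where
  open Graph G

  pos-inner : ∀ e i (0<i : 0 < i) (i<len : i < len e) → pos G e i ≡ inner e i 0<i i<len
  pos-inner e (suc k) 0<i i<len with suc k ℕ.<? len e
  ... | yes i<len′ = cong₂ (inner e (suc k)) (ℕₚ.<-irrelevant _ _) (ℕₚ.<-irrelevant _ _)
  ... | no  i≮len  = contradiction i<len i≮len

  pos-end : ∀ e i → i ≡ len e → pos G e i ≡ vert (tgt e)
  pos-end e zero    0≡len = contradiction (sym 0≡len) (ℕ.≢-nonZero⁻¹ (len e) {{len-nz e}})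
  pos-end e (suc k) i≡len with suc k ℕ.<? len e
  ... | yes i<len = contradiction (subst (suc k <_) (sym i≡len) i<len) (ℕₚ.<-irrefl refl)
  ... | no  _     = refl

  x-start : ∀ o → x G o 0 ≡ vert (tail G o)
  x-start (oe e true)  = refl
  x-start (oe e false) = pos-end e (len e) refl

  x-end : ∀ o → x G o (ℓ G o) ≡ vert (head G o)
  x-end (oe e true)  = pos-end e (len e) refl
  x-end (oe e false) = cong (pos G e) (ℕₚ.n∸n≡0 (len e))

  along : (VH G → ℤ) → OEdge G → ℕ → ℤ
  along F o j = F (x G o j)

  div-pos : ∀ F e i → Inner (len e) i → div G F (pos G e i) ≡ Δ (λ k → F (pos G e k)) i
  div-pos F e i (0<i , i<len) =
    subst (λ w → div G F w ≡ (F (pos G e (i ∸ 1)) - F w) + ((F (pos G e (suc i)) - F w) + + 0))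
          (sym (pos-inner e i 0<i i<len)) refl

  div-along : ∀ F o j → Interior G o j → div G F (x G o j) ≡ Δ (along F o) j
  div-along F (oe e true)  j ij = div-pos F e j ij
  div-along F (oe e false) j ij =
    trans (div-pos F e (len e ∸ j) (Inner-reverse ij)) (sym (Δ-reverse (λ k → F (pos G e k)) ij))

module _ (G : Graph) (D : Divisor G) (f : Fin (Graph.n G) → ℤ) where
  open Graph G

  D⊕div : (VH G → ℤ) → Divisor G
  D⊕div F = _⊕_ G D (div G F)

  edge-characterisation :
    ∀ F → Extends G F f → ∀ o → PathAdmissible (ℓ G o) (λ j → D⊕div F (x G o j)) →
    F (x G o 1) ≡ f (tail G o) + δ G f (tD G D) o
    × ConcentratedAt (ℓ G o) (rem G f (tD G D) o) (λ j → D⊕div F (x G o j))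
  edge-characterisation F ext o adm =
    let h₁≡ , conc = path-characterisation (ℓ G o) dₒ (along G F o) (λ j → D⊕div F (x G o j)) s
                       (λ j ij → cong (_+_ (dₒ j)) (div-along G F o j ij)) s≡ adm
    in trans h₁≡ (cong (_+ s /ℕ ℓ G o) start) , conc
    where
    instance _ = len-nz (edge o)
    s = slope G f (tD G D) o
    dₒ : ℕ → ℤ
    dₒ j = D (x G o j)
    start : F (x G o 0) ≡ f (tail G o)
    start = trans (cong F (x-start G o)) (ext (tail G o))
    end : F (x G o (ℓ G o)) ≡ f (head G o)
    end = trans (cong F (x-end G o)) (ext (head G o))
    s≡ : s ≡ along G F o (ℓ G o) - along G F o 0 + weightedSum (ℓ G o) dₒ
    s≡ = cong₂ _+_ (cong₂ _-_ (sym end) (sym start)) (sumTo≡∑ G (ℓ G o ∸ 1) (λ j → + (ℓ G o ∸ j) * dₒ j))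

  admissible⇒Prop1 : ∀ F → Extends G F f → Admissible G (D⊕div F) → Prop1 G D f F
  admissible⇒Prop1 F ext adm o = proj₂ (edge-characterisation F ext o (adm o))

  admissible⇒Prop2 : ∀ F → Extends G F f → Admissible G (D⊕div F) → Prop2 G D f F
  admissible⇒Prop2 F ext adm o = proj₁ (edge-characterisation F ext o (adm o))

  Prop1∧Prop2-unique : ∀ F₁ F₂ → Extends G F₁ f → Extends G F₂ f →
                       Prop1 G D f F₁ → Prop1 G D f F₂ → Prop2 G D f F₁ → Prop2 G D f F₂ →
                       ∀ w → F₁ w ≡ F₂ w
  Prop1∧Prop2-unique F₁ F₂ ext₁ ext₂ _ _ _ _ (vert v) = trans (ext₁ v) (sym (ext₂ v))
  Prop1∧Prop2-unique F₁ F₂ ext₁ ext₂ P1₁ P1₂ P2₁ P2₂ (inner e i 0<i i<len) =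
    subst (λ w → F₁ w ≡ F₂ w) (pos-inner G e i 0<i i<len)
          (Δ-determines {len e} {along G F₁ o} {along G F₂ o} same-start same-slope sameΔ i (ℕₚ.<⇒≤ i<len))
    where
    o = oe e true
    same-start = trans (ext₁ (src e)) (sym (ext₂ (src e)))
    same-slope = trans (P2₁ o) (sym (P2₂ o))
    sameΔ : ∀ j → Inner (len e) j → Δ (along G F₁ o) j ≡ Δ (along G F₂ o) j
    sameΔ j ij = ∙-cancelˡ (D (pos G e j)) _ _ (begin
      D (pos G e j) + Δ (along G F₁ o) j  ≡⟨ cong (_+_ (D (pos G e j))) (div-along G F₁ o j ij) ⟨
      D⊕div F₁ (pos G e j)                ≡⟨ concentrated-unique (P1₁ o) (P1₂ o) j ij ⟩
      D⊕div F₂ (pos G e j)                ≡⟨ cong (_+_ (D (pos G e j))) (div-along G F₂ o j ij) ⟩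
      D (pos G e j) + Δ (along G F₂ o) j  ∎)

  edge-solution : ∀ e → Σ[ h ∈ (ℕ → ℤ) ] h 0 ≡ f (src e) × h (len e) ≡ f (tgt e)
                                          × PathAdmissible (len e) (λ j → D (pos G e j) + Δ h j)
  edge-solution e = path-existence (len e) {{len-nz e}} (λ j → D (pos G e j)) (f (src e)) (f (tgt e))

  extension : VH G → ℤ
  extension (vert v)        = f v
  extension (inner e i _ _) = proj₁ (edge-solution e) i

  extension-extends : Extends G extension f
  extension-extends v = refl

  extension-along : ∀ e i → i ≤ len e → extension (pos G e i) ≡ proj₁ (edge-solution e) i
  extension-along e zero    _     = sym (proj₁ (proj₂ (edge-solution e)))
  extension-along e (suc k) i≤len with ℕₚ.m≤n⇒m<n∨m≡n i≤len
  ... | inj₁ i<len = cong extension (pos-inner G e (suc k) (s≤s z≤n) i<len)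
  ... | inj₂ i≡len = trans (cong extension (pos-end G e (suc k) i≡len))
                           (sym (subst (λ i → proj₁ (edge-solution e) i ≡ f (tgt e)) (sym i≡len)
                                       (proj₁ (proj₂ (proj₂ (edge-solution e))))))

  extension-admissible : Admissible G (D⊕div extension)
  extension-admissible (oe e true)  = PathAdmissible-resp
    (λ j ij → cong (_+_ (D (pos G e j)))
                   (sym (trans (div-along G extension (oe e true) j ij) (Δ-cong-≤ (extension-along e) ij))))
    (proj₂ (proj₂ (proj₂ (edge-solution e))))
  extension-admissible (oe e false) = PathAdmissible-reverse (extension-admissible (oe e true))

mainTheorem2 : (G : Graph) → Connected G → (D : Divisor G) →
    (f : Fin (Graph.n G) → ℤ) →
    Σ[ F ∈ (VH G → ℤ) ]
      ( Extends G F f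
      × Admissible G (_⊕_ G D (div G F))
      × (∀ F' → Extends G F' f → Admissible G (_⊕_ G D (div G F')) →
           ∀ w → F' w ≡ F w)
      × Prop1 G D f F
      × Prop2 G D f F
      × (∀ F' → Extends G F' f → Prop1 G D f F' → Prop2 G D f F' →
           ∀ w → F' w ≡ F w) )
mainTheorem2 G _ D f =
  F , F-extends , F-admissible ,
  (λ F′ ext adm → unique F′ ext (admissible⇒Prop1 G D f F′ ext adm)
                                (admissible⇒Prop2 G D f F′ ext adm)) ,
  F-Prop1 , F-Prop2 , unique
  where
  F = extension G D f
  F-extends = extension-extends G D f
  F-admissible = extension-admissible G D f
  F-Prop1 = admissible⇒Prop1 G D f F F-extends F-admissible
  F-Prop2 = admissible⇒Prop2 G D f F F-extends F-admissible
  unique : ∀ F′ → Extends G F′ f → Prop1 G D f F′ → Prop2 G D f F′ → ∀ w → F′ w ≡ F w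
  unique F′ ext P1 P2 = Prop1∧Prop2-unique G D f F′ F ext F-extends P1 F-Prop1 P2 F-Prop2
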